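{- For all $n\ge1$: $$\gamma^-(L_{2n})=0^{2n-2},\quad \gamma^-(L_{2n+1})=(01)^{n-1},\quad \gamma^-(L_{2n+1}+1)=(10)^n,\quad \gamma^-(L_{2n+2}-1)=0^{2n},$$ and consequently $$\mathcal C(L_{2n})=0,\quad \mathcal C(L_{2n+1})=F_{2n-1}-1,\quad \mathcal C(L_{2n+1}+1)=F_{2n+2}-1,\quad \mathcal C(L_{2n+2}-1)=0.$$
   Context: Let $\varphi=(1+\sqrt5)/2$. Every integer $N\ge1$ has a unique base phi expansion $N=\sum_{i\in\mathbb Z} d_i\varphi^i$ with $d_i\in\{0,1\}$, finitely many nonzero, $d_id_{i+1}=0$; with $R$ the smallest index with $d_R=1$, $\beta^-(N)=d_{ -1}\cdots d_R$. For $N\ge2$, $\beta^-(N)$ ends in $01$, and $\gamma^-(N)$ is $\beta^-(N)$ with this final $01$ removed. Fibonacci numbers $F_0=0,F_1=1$, $F_{n}=F_{n-1}+F_{n-2}$; Lucas numbers $L_0=2,L_1=1$, $L_n=L_{n-1}+L_{n-2}$. For a word $e_k\cdots e_0$ over $\{0,1\}$ with no factor $11$, $Z^{ -1}(e_k\cdots e_0)=\sum_i e_iF_{i+2}$ (the number with that Zeckendorf expansion, leading zeros ignored; the empty word gives $0$). $\mathcal C(N):=Z^{ -1}(\gamma^-(N))$. $0^k$ is the word of $k$ zeros and $(01)^k$, $(10)^k$ are $k$-fold repetitions. -}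

module Defs where

open import Data.Nat as ℕ using (ℕ; zero; suc)
open import Data.Integer as ℤ using (ℤ; +_; -[1+_])
open import Data.Bool using (Bool; true; false; if_then_else_; _∨_)
open import Data.List using (List; []; _∷_; _++_; map; replicate; concat; reverse; length; take; upTo)
open import Data.Product using (_×_; _,_; ∃)
open import Data.Unit using (⊤)
open import Relation.Binary.PropositionalEquality using (_≡_)
open import Relation.Nullary.Decidable using (⌊_⌋)

fib : ℕ → ℕ
fib 0 = 0
fib 1 = 1
fib (suc (suc n)) = fib (suc n) ℕ.+ fib n

lucas : ℕ → ℕ
lucas 0 = 2
lucas 1 = 1
lucas (suc (suc n)) = lucas (suc n) ℕ.+ lucas n

-- The ring ℤ[φ]: a pair (a , b) denotes a + b φ, where φ² = φ + 1.
-- (This is an exact model of the subring of ℝ generated by φ.)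

Zφ : Set
Zφ = ℤ × ℤ

_⊕_ : Zφ → Zφ → Zφ
(a , b) ⊕ (c , d) = (a ℤ.+ c) , (b ℤ.+ d)

_⊗_ : Zφ → Zφ → Zφ
(a , b) ⊗ (c , d) = (a ℤ.* c ℤ.+ b ℤ.* d) , (a ℤ.* d ℤ.+ b ℤ.* c ℤ.+ b ℤ.* d)

oneφ : Zφ
oneφ = + 1 , + 0

φ : Zφ
φ = + 0 , + 1

-- φ⁻¹ = φ - 1
φinv : Zφ
φinv = ℤ.- (+ 1) , + 1

powℕ : Zφ → ℕ → Zφ
powℕ x zero = oneφ
powℕ x (suc n) = x ⊗ powℕ x n

φ^ : ℤ → Zφ
φ^ (+ n) = powℕ φ n
φ^ -[1+ n ] = powℕ φinv (suc n)

fromℕ : ℕ → Zφ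
fromℕ n = + n , + 0

-- An expansion is represented by the list of the
-- indices i with d_i = 1, listed in strictly decreasing order.  The
-- condition d_i d_{i+1} = 0 (together with distinctness) says that
-- consecutive listed indices differ by at least 2.

Gapped : List ℤ → Set
Gapped [] = ⊤
Gapped (x ∷ []) = ⊤
Gapped (x ∷ y ∷ es) = (y ℤ.+ + 2 ℤ.≤ x) × Gapped (y ∷ es)

expValue : List ℤ → Zφ
expValue [] = + 0 , + 0
expValue (e ∷ es) = φ^ e ⊕ expValue es

IsBasePhiExp : ℕ → List ℤ → Set
IsBasePhiExp N E = Gapped E × expValue E ≡ fromℕ N

digit : List ℤ → ℤ → Bool
digit [] i = false
digit (e ∷ es) i = ⌊ e ℤ.≟ i ⌋ ∨ digit es i

-- -R when R < 0 (i.e. the largest m with d_{-m} = 1), and 0 if there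
-- is no negative index.
negDepth : List ℤ → ℕ
negDepth [] = 0
negDepth (+ n ∷ es) = negDepth es
negDepth (-[1+ k ] ∷ es) = suc k ℕ.⊔ negDepth es

-- β^-: the word d_{-1} d_{-2} ⋯ d_R (leftmost letter is d_{-1}).
betaMinus : List ℤ → List Bool
betaMinus E = map (λ k → digit E -[1+ k ]) (upTo (negDepth E))

-- γ^-: remove the final two letters (the final 01) of β^-.
gammaMinusW : List Bool → List Bool
gammaMinusW w = take (length w ℕ.∸ 2) w

-- Z^{-1}(e_k ⋯ e_0) = Σ e_i F_{i+2}; the word is written with e_k first.
zinvRev : List Bool → ℕ → ℕ
zinvRev [] i = 0
zinvRev (b ∷ bs) i = (if b then fib (i ℕ.+ 2) else 0) ℕ.+ zinvRev bs (suc i)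

Zinv : List Bool → ℕ
Zinv w = zinvRev (reverse w) 0

-- "γ^-(N) = w": N has a base phi expansion, and (for the, unique,
-- expansion) γ^- of it is w.
GammaMinusIs : ℕ → List Bool → Set
GammaMinusIs N w =
  ∃ (λ E → IsBasePhiExp N E) ×
  (∀ E → IsBasePhiExp N E → gammaMinusW (betaMinus E) ≡ w)

CIs : ℕ → ℕ → Set
CIs N c =
  ∃ (λ E → IsBasePhiExp N E) ×
  (∀ E → IsBasePhiExp N E → Zinv (gammaMinusW (betaMinus E)) ≡ c)

zeros : ℕ → List Bool
zeros k = replicate k false

w01 : ℕ → List Bool
w01 k = concat (replicate k (false ∷ true ∷ []))

w10 : ℕ → List Bool
w10 k = concat (replicate k (true ∷ false ∷ []))

module Submission where

-- Each of the four numbers has an explicit base-φ expansion, obtained from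
-- L_m = φ^m + (−φ)^(−m) and telescoping with φ^j + φ^(j+1) = φ^(j+2):
--   L_2n       = φ^2n + φ^−2n,
--   L_(2n+1)   = (φ^2n + φ^(2n−2) + ⋯ + φ^0) + (φ^−2 + φ^−4 + ⋯ + φ^−2n),
--   L_(2n+1)+1 = φ^(2n+1) + (φ^−1 + φ^−3 + ⋯ + φ^(1−2n)) + φ^(−2n−2),
--   L_(2n+2)−1 = (φ^(2n+1) + φ^(2n−1) + ⋯ + φ^1) + φ^(−2n−2).
-- Their negative digits spell the four words followed by 01. Base-φ expansions
-- are unique: multiplying by a power of φ makes all exponents nonnegative, and
-- a + bφ ↦ a + 2b then maps the expansion to a Zeckendorf representation.

open import Defs
open import Data.Nat as Nat using (ℕ; zero; suc; z≤n; s≤s)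
import Data.Nat.Properties as ℕₚ
import Data.Nat.Tactic.RingSolver as ℕ-Solver
open import Data.Integer as Int using (ℤ; +_; -[1+_]; +≤+; -≤-; -≤+)
import Data.Integer.Properties as ℤₚ
open import Data.Integer.Tactic.RingSolver using (solve-∀)
open import Algebra.Bundles using (AbelianGroup)
open import Algebra.Properties.Group (AbelianGroup.group ℤₚ.+-0-abelianGroup)
  using () renaming (∙-cancelʳ to ℤ-+-cancelʳ)
open import Data.List
  using (List; []; _∷_; _++_; _∷ʳ_; map; length; take; upTo; applyUpTo; replicate; concat; reverse)
import Data.List.Properties as Listₚ
open import Data.Unit using (⊤; tt)
open import Data.Empty using (⊥-elim)
open import Data.Bool using (Bool; true; false; _∨_; if_then_else_)
open import Relation.Nullary using (Dec; ¬_)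
open import Relation.Nullary.Decidable using (⌊_⌋; isYes≗does; dec-true; dec-false)
open import Relation.Binary using (tri<; tri≈; tri>)
open import Data.Product using (Σ; _×_; _,_; proj₁; proj₂)
open import Function using (_∘_)
open import Function.Definitions using (Injective)
open import Relation.Binary.PropositionalEquality
open ≡-Reasoning

module FibonacciLucas where
  open Nat using (_+_; _≤_; _<_)

  fib-pos : ∀ n → 1 ≤ fib (suc n)
  fib-pos zero    = s≤s z≤n
  fib-pos (suc n) = ℕₚ.≤-trans (fib-pos n) (ℕₚ.m≤m+n (fib (suc n)) (fib n))

  fib-mono : ∀ {m n} → m ≤ n → fib m ≤ fib n
  fib-mono {n = n} z≤n = z≤n
  fib-mono {n = suc n} (s≤s {zero} m≤n) = fib-pos n
  fib-mono {n = suc (suc n)} (s≤s {suc m} m≤n) = ℕₚ.+-mono-≤ (fib-mono m≤n) (fib-mono (ℕₚ.≤-pred m≤n))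

  lucas-pos : ∀ n → 1 ≤ lucas n
  lucas-pos zero          = s≤s z≤n
  lucas-pos (suc zero)    = s≤s z≤n
  lucas-pos (suc (suc n)) = ℕₚ.≤-trans (lucas-pos (suc n)) (ℕₚ.m≤m+n _ _)

  lucas-fib : ∀ k → lucas (suc k) ≡ fib k + fib (suc (suc k))
  lucas-fib zero          = refl
  lucas-fib (suc zero)    = refl
  lucas-fib (suc (suc k)) = begin
    lucas (suc (suc k)) + lucas (suc k)
      ≡⟨ cong₂ _+_ (lucas-fib (suc k)) (lucas-fib k) ⟩
    (fib (suc k) + fib (suc (suc (suc k)))) + (fib k + fib (suc (suc k)))
      ≡⟨ l (fib k) (fib (suc k)) ⟩
    fib (suc (suc k)) + fib (suc (suc (suc (suc k)))) ∎
    where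
    l : ∀ a b → (b + ((b + a) + b)) + (a + (b + a)) ≡ (b + a) + (((b + a) + b) + (b + a))
    l = ℕ-Solver.solve-∀

module ℤ[φ] where
  open Int using (_+_; _*_; -_)

  0φ : Zφ
  0φ = + 0 , + 0

  ⊕-identityˡ : ∀ x → 0φ ⊕ x ≡ x
  ⊕-identityˡ (a , b) = cong₂ _,_ (ℤₚ.+-identityˡ a) (ℤₚ.+-identityˡ b)

  ⊕-identityʳ : ∀ x → x ⊕ 0φ ≡ x
  ⊕-identityʳ (a , b) = cong₂ _,_ (ℤₚ.+-identityʳ a) (ℤₚ.+-identityʳ b)

  ⊕-assoc : ∀ x y z → (x ⊕ y) ⊕ z ≡ x ⊕ (y ⊕ z)
  ⊕-assoc (a , b) (c , d) (e , f) = cong₂ _,_ (ℤₚ.+-assoc a c e) (ℤₚ.+-assoc b d f)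

  ⊕-comm : ∀ x y → x ⊕ y ≡ y ⊕ x
  ⊕-comm (a , b) (c , d) = cong₂ _,_ (ℤₚ.+-comm a c) (ℤₚ.+-comm b d)

  ⊕-swapʳ : ∀ x y z → (x ⊕ y) ⊕ z ≡ (x ⊕ z) ⊕ y
  ⊕-swapʳ x y z = begin
    (x ⊕ y) ⊕ z ≡⟨ ⊕-assoc x y z ⟩
    x ⊕ (y ⊕ z) ≡⟨ cong (x ⊕_) (⊕-comm y z) ⟩
    x ⊕ (z ⊕ y) ≡⟨ ⊕-assoc x z y ⟨
    (x ⊕ z) ⊕ y ∎

  ⊕-cancelʳ : ∀ z x y → x ⊕ z ≡ y ⊕ z → x ≡ y
  ⊕-cancelʳ (e , f) (a , b) (c , d) eq =
    cong₂ _,_ (ℤ-+-cancelʳ e a c (cong proj₁ eq)) (ℤ-+-cancelʳ f b d (cong proj₂ eq))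

  ⊗-identityˡ : ∀ x → oneφ ⊗ x ≡ x
  ⊗-identityˡ (a , b) = cong₂ _,_ (l₁ a b) (l₂ a b)
    where
    l₁ : ∀ a b → + 1 * a + + 0 * b ≡ a
    l₁ = solve-∀
    l₂ : ∀ a b → + 1 * b + + 0 * a + + 0 * b ≡ b
    l₂ = solve-∀

  ⊗-zeroʳ : ∀ x → x ⊗ 0φ ≡ 0φ
  ⊗-zeroʳ (a , b) = cong₂ _,_ (l₁ a b) (l₂ a b)
    where
    l₁ : ∀ a b → a * + 0 + b * + 0 ≡ + 0
    l₁ = solve-∀
    l₂ : ∀ a b → a * + 0 + b * + 0 + b * + 0 ≡ + 0
    l₂ = solve-∀

  ⊗-assoc : ∀ x y z → (x ⊗ y) ⊗ z ≡ x ⊗ (y ⊗ z)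
  ⊗-assoc (a , b) (c , d) (e , f) = cong₂ _,_ (l₁ a b c d e f) (l₂ a b c d e f)
    where
    l₁ : ∀ a b c d e f →
         (a * c + b * d) * e + (a * d + b * c + b * d) * f
           ≡ a * (c * e + d * f) + b * (c * f + d * e + d * f)
    l₁ = solve-∀
    l₂ : ∀ a b c d e f →
         (a * c + b * d) * f + (a * d + b * c + b * d) * e + (a * d + b * c + b * d) * f
           ≡ a * (c * f + d * e + d * f) + b * (c * e + d * f) + b * (c * f + d * e + d * f)
    l₂ = solve-∀

  ⊗-distribˡ-⊕ : ∀ x y z → x ⊗ (y ⊕ z) ≡ (x ⊗ y) ⊕ (x ⊗ z)
  ⊗-distribˡ-⊕ (a , b) (c , d) (e , f) = cong₂ _,_ (l₁ a b c d e f) (l₂ a b c d e f)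
    where
    l₁ : ∀ a b c d e f → a * (c + e) + b * (d + f) ≡ (a * c + b * d) + (a * e + b * f)
    l₁ = solve-∀
    l₂ : ∀ a b c d e f →
         a * (d + f) + b * (c + e) + b * (d + f) ≡ (a * d + b * c + b * d) + (a * f + b * e + b * f)
    l₂ = solve-∀

  ⊗-distribʳ-⊕ : ∀ x y z → (y ⊕ z) ⊗ x ≡ (y ⊗ x) ⊕ (z ⊗ x)
  ⊗-distribʳ-⊕ (a , b) (c , d) (e , f) = cong₂ _,_ (l₁ a b c d e f) (l₂ a b c d e f)
    where
    l₁ : ∀ a b c d e f → (c + e) * a + (d + f) * b ≡ (c * a + d * b) + (e * a + f * b)
    l₁ = solve-∀
    l₂ : ∀ a b c d e f →
         (c + e) * b + (d + f) * a + (d + f) * b ≡ (c * b + d * a + d * b) + (e * b + f * a + f * b)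
    l₂ = solve-∀

  φ⊗φ≡φ⊕1 : φ ⊗ φ ≡ φ ⊕ oneφ
  φ⊗φ≡φ⊕1 = refl

  φ⊗φinv≡1 : φ ⊗ φinv ≡ oneφ
  φ⊗φinv≡1 = refl

  φ-golden : ∀ x → φ ⊗ (φ ⊗ x) ≡ (φ ⊗ x) ⊕ x
  φ-golden x = begin
    φ ⊗ (φ ⊗ x)          ≡⟨ ⊗-assoc φ φ x ⟨
    (φ ⊗ φ) ⊗ x          ≡⟨ cong (_⊗ x) φ⊗φ≡φ⊕1 ⟩
    (φ ⊕ oneφ) ⊗ x       ≡⟨ ⊗-distribʳ-⊕ x φ oneφ ⟩
    (φ ⊗ x) ⊕ (oneφ ⊗ x) ≡⟨ cong ((φ ⊗ x) ⊕_) (⊗-identityˡ x) ⟩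
    (φ ⊗ x) ⊕ x          ∎

  φ-cancels-φinv : ∀ x → φ ⊗ (φinv ⊗ x) ≡ x
  φ-cancels-φinv x = begin
    φ ⊗ (φinv ⊗ x) ≡⟨ ⊗-assoc φ φinv x ⟨
    (φ ⊗ φinv) ⊗ x ≡⟨ cong (_⊗ x) φ⊗φinv≡1 ⟩
    oneφ ⊗ x       ≡⟨ ⊗-identityˡ x ⟩
    x              ∎

module Powers where
  open ℤ[φ]
  open FibonacciLucas using (lucas-fib)
  open Int using (_+_; _*_; -_)

  φ^-recurrence : ∀ n → powℕ φ (suc n) ⊕ powℕ φ n ≡ powℕ φ (suc (suc n))
  φ^-recurrence n = sym (φ-golden (powℕ φ n))

  φinv^-recurrence : ∀ n → powℕ φinv (suc n) ⊕ powℕ φinv (suc (suc n)) ≡ powℕ φinv n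
  φinv^-recurrence n = begin
    powℕ φinv (suc n) ⊕ y ≡⟨ cong (_⊕ y) (φ-cancels-φinv (powℕ φinv (suc n))) ⟨
    (φ ⊗ y) ⊕ y           ≡⟨ φ-golden y ⟨
    φ ⊗ (φ ⊗ y)           ≡⟨ cong (φ ⊗_) (φ-cancels-φinv (powℕ φinv (suc n))) ⟩
    φ ⊗ powℕ φinv (suc n) ≡⟨ φ-cancels-φinv (powℕ φinv n) ⟩
    powℕ φinv n           ∎
    where y = powℕ φinv (suc (suc n))

  φ⊗φ^ : ∀ e → φ ⊗ φ^ e ≡ φ^ (e + + 1)
  φ⊗φ^ (+ n)          = cong (powℕ φ) (ℕₚ.+-comm 1 n)
  φ⊗φ^ -[1+ zero ]    = φ-cancels-φinv oneφ
  φ⊗φ^ -[1+ suc m ]   = φ-cancels-φinv (powℕ φinv (suc m))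

  φ^-+ : ∀ k e → powℕ φ k ⊗ φ^ e ≡ φ^ (e + + k)
  φ^-+ zero e = trans (⊗-identityˡ (φ^ e)) (cong φ^ (sym (ℤₚ.+-identityʳ e)))
  φ^-+ (suc k) e = begin
    (φ ⊗ powℕ φ k) ⊗ φ^ e  ≡⟨ ⊗-assoc φ (powℕ φ k) (φ^ e) ⟩
    φ ⊗ (powℕ φ k ⊗ φ^ e)  ≡⟨ cong (φ ⊗_) (φ^-+ k e) ⟩
    φ ⊗ φ^ (e + + k)       ≡⟨ φ⊗φ^ (e + + k) ⟩
    φ^ (e + + k + + 1)     ≡⟨ cong φ^ (ℤₚ.+-assoc e (+ k) (+ 1)) ⟩
    φ^ (e + + (k Nat.+ 1)) ≡⟨ cong (λ t → φ^ (e + + t)) (ℕₚ.+-comm k 1) ⟩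
    φ^ (e + + suc k)       ∎

  φ^-fib : ∀ j → powℕ φ (suc j) ≡ (+ fib j , + fib (suc j))
  φ^-fib zero = refl
  φ^-fib (suc j) = begin
    φ ⊗ powℕ φ (suc j)
      ≡⟨ cong (φ ⊗_) (φ^-fib j) ⟩
    φ ⊗ (+ fib j , + fib (suc j))
      ≡⟨ cong₂ _,_ (l₁ (+ fib j) (+ fib (suc j))) (l₂ (+ fib j) (+ fib (suc j))) ⟩
    (+ fib (suc j) , + fib (suc (suc j))) ∎
    where
    l₁ : ∀ a b → + 0 * a + + 1 * b ≡ b
    l₁ = solve-∀
    l₂ : ∀ a b → + 0 * b + + 1 * a + + 1 * b ≡ b + a
    l₂ = solve-∀

  φinv^-odd : ∀ i → powℕ φinv (suc (i Nat.+ i))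
                      ≡ (- + fib (suc (suc (i Nat.+ i))) , + fib (suc (i Nat.+ i)))
  φinv^-even : ∀ i → powℕ φinv (suc (suc (i Nat.+ i)))
                       ≡ (+ fib (suc (suc (suc (i Nat.+ i)))) , - + fib (suc (suc (i Nat.+ i))))

  φinv^-odd zero = refl
  φinv^-odd (suc i) rewrite ℕₚ.+-suc i i = begin
    φinv ⊗ powℕ φinv (suc (suc k))
      ≡⟨ cong (φinv ⊗_) (φinv^-even i) ⟩
    φinv ⊗ (+ fib (suc (suc (suc k))) , - + fib (suc (suc k)))
      ≡⟨ cong₂ _,_ (l₁ (+ fib (suc (suc (suc k)))) (+ fib (suc (suc k))))
                   (l₂ (+ fib (suc (suc (suc k)))) (+ fib (suc (suc k)))) ⟩
    (- + fib (suc (suc (suc (suc k)))) , + fib (suc (suc (suc k)))) ∎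
    where
    k = i Nat.+ i
    l₁ : ∀ a b → - + 1 * a + + 1 * - b ≡ - (a + b)
    l₁ = solve-∀
    l₂ : ∀ a b → - + 1 * - b + + 1 * a + + 1 * - b ≡ a
    l₂ = solve-∀

  φinv^-even i = begin
    φinv ⊗ powℕ φinv (suc k)
      ≡⟨ cong (φinv ⊗_) (φinv^-odd i) ⟩
    φinv ⊗ (- + fib (suc (suc k)) , + fib (suc k))
      ≡⟨ cong₂ _,_ (l₁ (+ fib (suc k)) (+ fib (suc (suc k))))
                   (l₂ (+ fib (suc k)) (+ fib (suc (suc k)))) ⟩
    (+ fib (suc (suc (suc k))) , - + fib (suc (suc k))) ∎
    where
    k = i Nat.+ i
    l₁ : ∀ a b → - + 1 * - b + + 1 * a ≡ b + a
    l₁ = solve-∀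
    l₂ : ∀ a b → - + 1 * a + + 1 * - b + + 1 * a ≡ - b
    l₂ = solve-∀

  lucas-even : ∀ i → let n = suc (suc (i Nat.+ i)) in
               powℕ φ n ⊕ powℕ φinv n ≡ fromℕ (lucas n)
  lucas-even i = begin
    powℕ φ (suc (suc k)) ⊕ powℕ φinv (suc (suc k))
      ≡⟨ cong₂ _⊕_ (φ^-fib (suc k)) (φinv^-even i) ⟩
    (+ fib (suc k) + + fib (suc (suc (suc k))) , + fib (suc (suc k)) + - + fib (suc (suc k)))
      ≡⟨ cong₂ _,_ (cong +_ (sym (lucas-fib (suc k)))) (ℤₚ.+-inverseʳ (+ fib (suc (suc k)))) ⟩
    fromℕ (lucas (suc (suc k))) ∎
    where k = i Nat.+ i

  lucas-odd : ∀ i → let n = suc (i Nat.+ i) in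
              fromℕ (lucas n) ⊕ powℕ φinv n ≡ powℕ φ n
  lucas-odd i = begin
    fromℕ (lucas (suc k)) ⊕ powℕ φinv (suc k)
      ≡⟨ cong₂ _⊕_ (cong fromℕ (lucas-fib k)) (φinv^-odd i) ⟩
    (+ (fib k Nat.+ fib (suc (suc k))) + - + fib (suc (suc k)) , + 0 + + fib (suc k))
      ≡⟨ cong₂ _,_ (l (+ fib k) (+ fib (suc (suc k)))) refl ⟩
    (+ fib k , + fib (suc k))
      ≡⟨ φ^-fib k ⟨
    powℕ φ (suc k) ∎
    where
    k = i Nat.+ i
    l : ∀ a b → (a + b) + - b ≡ a
    l = solve-∀

module Zeckendorf where
  open Nat using (_+_; _≤_; _<_)
  open FibonacciLucas using (fib-pos; fib-mono)

  Gappedℕ : List ℕ → Set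
  Gappedℕ []          = ⊤
  Gappedℕ (x ∷ [])    = ⊤
  Gappedℕ (x ∷ y ∷ l) = suc (suc y) ≤ x × Gappedℕ (y ∷ l)

  Gappedℕ-tail : ∀ {x l} → Gappedℕ (x ∷ l) → Gappedℕ l
  Gappedℕ-tail {l = []}    _       = tt
  Gappedℕ-tail {l = _ ∷ _} (_ , g) = g

  zeckendorfSum : List ℕ → ℕ
  zeckendorfSum []      = 0
  zeckendorfSum (x ∷ l) = fib (suc (suc x)) + zeckendorfSum l

  zeckendorfSum-< : ∀ {x l} → Gappedℕ (x ∷ l) → zeckendorfSum (x ∷ l) < fib (suc (suc (suc x)))
  zeckendorfSum-< {x} {[]} _ = ℕₚ.+-monoʳ-< (fib (suc (suc x))) (fib-pos x)
  zeckendorfSum-< {x} {y ∷ l} (y+2≤x , g) = ℕₚ.+-monoʳ-< (fib (suc (suc x)))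
    (ℕₚ.<-≤-trans (zeckendorfSum-< g) (fib-mono (s≤s y+2≤x)))

  zeckendorfSum-<-head : ∀ {x y l l'} → Gappedℕ (x ∷ l) → x < y →
                         zeckendorfSum (x ∷ l) < zeckendorfSum (y ∷ l')
  zeckendorfSum-<-head {l' = l'} g x<y = ℕₚ.<-≤-trans (zeckendorfSum-< g)
    (ℕₚ.≤-trans (fib-mono (s≤s (s≤s x<y))) (ℕₚ.m≤m+n _ (zeckendorfSum l')))

  zeckendorfSum-injective : ∀ {l l'} → Gappedℕ l → Gappedℕ l' →
                            zeckendorfSum l ≡ zeckendorfSum l' → l ≡ l'
  zeckendorfSum-injective {[]} {[]} _ _ _ = refl
  zeckendorfSum-injective {[]} {y ∷ l'} _ _ eq =
    ⊥-elim (ℕₚ.<⇒≢ (ℕₚ.≤-trans (fib-pos (suc y)) (ℕₚ.m≤m+n _ (zeckendorfSum l'))) eq)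
  zeckendorfSum-injective {x ∷ l} {[]} _ _ eq =
    ⊥-elim (ℕₚ.<⇒≢ (ℕₚ.≤-trans (fib-pos (suc x)) (ℕₚ.m≤m+n _ (zeckendorfSum l))) (sym eq))
  zeckendorfSum-injective {x ∷ l} {y ∷ l'} g g' eq with ℕₚ.<-cmp x y
  ... | tri< x<y _ _ = ⊥-elim (ℕₚ.<⇒≢ (zeckendorfSum-<-head {l' = l'} g x<y) eq)
  ... | tri> _ _ y<x = ⊥-elim (ℕₚ.<⇒≢ (zeckendorfSum-<-head {l' = l} g' y<x) (sym eq))
  ... | tri≈ _ refl _ = cong (x ∷_) (zeckendorfSum-injective (Gappedℕ-tail g) (Gappedℕ-tail g')
                          (ℕₚ.+-cancelˡ-≡ (fib (suc (suc x))) _ _ eq))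

module Uniqueness where
  open ℤ[φ]
  open Powers using (φ^-+; φ^-fib)
  open Zeckendorf

  -- ζ (a + bφ) = a + 2b is additive and sends φ^j to F_{j+2}: it turns an expansion
  -- with nonnegative exponents into the corresponding Zeckendorf sum.
  ζ : Zφ → ℤ
  ζ (a , b) = a Int.+ (b Int.+ b)

  ζ-⊕ : ∀ x y → ζ (x ⊕ y) ≡ ζ x Int.+ ζ y
  ζ-⊕ (a , b) (c , d) = l a b c d
    where
    open Int using (_+_)
    l : ∀ a b c d → (a + c) + ((b + d) + (b + d)) ≡ (a + (b + b)) + (c + (d + d))
    l = solve-∀

  ζ-φ^ : ∀ j → ζ (powℕ φ j) ≡ + fib (suc (suc j))
  ζ-φ^ zero = refl
  ζ-φ^ (suc j) = trans (cong ζ (φ^-fib j)) (cong +_ (l (fib j) (fib (suc j))))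
    where
    l : ∀ a b → a Nat.+ (b Nat.+ b) ≡ (b Nat.+ a) Nat.+ b
    l = ℕ-Solver.solve-∀

  ζ-expValue : ∀ L → ζ (expValue (map +_ L)) ≡ + zeckendorfSum L
  ζ-expValue []      = refl
  ζ-expValue (x ∷ L) =
    trans (ζ-⊕ (powℕ φ x) (expValue (map +_ L))) (cong₂ Int._+_ (ζ-φ^ x) (ζ-expValue L))

  shift : ℕ → List ℤ → List ℤ
  shift k = map (Int._+ + k)

  Gapped-shift : ∀ k E → Gapped E → Gapped (shift k E)
  Gapped-shift k []          _          = tt
  Gapped-shift k (x ∷ [])    _          = tt
  Gapped-shift k (x ∷ y ∷ E) (y+2≤x , g) =
    subst (Int._≤ x Int.+ + k) (l y (+ k)) (ℤₚ.+-monoˡ-≤ (+ k) y+2≤x) , Gapped-shift k (y ∷ E) g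
    where
    open Int using (_+_)
    l : ∀ y k → (y + + 2) + k ≡ (y + k) + + 2
    l = solve-∀

  expValue-shift : ∀ k E → expValue (shift k E) ≡ powℕ φ k ⊗ expValue E
  expValue-shift k []      = sym (⊗-zeroʳ (powℕ φ k))
  expValue-shift k (e ∷ E) = begin
    φ^ (e Int.+ + k) ⊕ expValue (shift k E)
      ≡⟨ cong₂ _⊕_ (φ^-+ k e) (sym (expValue-shift k E)) ⟨
    (powℕ φ k ⊗ φ^ e) ⊕ (powℕ φ k ⊗ expValue E)
      ≡⟨ ⊗-distribˡ-⊕ (powℕ φ k) (φ^ e) (expValue E) ⟨
    powℕ φ k ⊗ (φ^ e ⊕ expValue E) ∎

  shift-injective : ∀ k → Injective _≡_ _≡_ (shift k)
  shift-injective k = Listₚ.map-injective (ℤ-+-cancelʳ (+ k) _ _)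

  Gappedℕ-from-Gapped : ∀ L → Gapped (map +_ L) → Gappedℕ L
  Gappedℕ-from-Gapped []          _          = tt
  Gappedℕ-from-Gapped (x ∷ [])    _          = tt
  Gappedℕ-from-Gapped (x ∷ y ∷ L) (y+2≤x , g) =
    ℤₚ.drop‿+≤+ (subst (Int._≤ + x) (cong +_ (ℕₚ.+-comm y 2)) y+2≤x) , Gappedℕ-from-Gapped (y ∷ L) g

  natExponents : ∀ k E → negDepth E Nat.≤ k → Σ (List ℕ) (λ L → map +_ L ≡ shift k E)
  natExponents k [] _ = [] , refl
  natExponents k (+ n ∷ E) d with natExponents k E d
  ... | L , eq = (n Nat.+ k) ∷ L , cong (+ (n Nat.+ k) ∷_) eq
  natExponents k (-[1+ j ] ∷ E) d with natExponents k E (ℕₚ.m⊔n≤o⇒n≤o (suc j) (negDepth E) d)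
  ... | L , eq = (k Nat.∸ suc j) ∷ L
               , cong₂ _∷_ (sym (ℤₚ.⊖-≥ (ℕₚ.m⊔n≤o⇒m≤o (suc j) (negDepth E) d))) eq

  zeckendorfForm : ∀ {N E} k → negDepth E Nat.≤ k → IsBasePhiExp N E →
    Σ (List ℕ) λ L → map +_ L ≡ shift k E × Gappedℕ L × + zeckendorfSum L ≡ ζ (powℕ φ k ⊗ fromℕ N)
  zeckendorfForm {N} {E} k d (g , v) = L , eq , gappedℕ , sum
    where
    L  = proj₁ (natExponents k E d)
    eq = proj₂ (natExponents k E d)
    gappedℕ : Gappedℕ L
    gappedℕ = Gappedℕ-from-Gapped L (subst Gapped (sym eq) (Gapped-shift k E g))
    sum : + zeckendorfSum L ≡ ζ (powℕ φ k ⊗ fromℕ N)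
    sum = begin
      + zeckendorfSum L         ≡⟨ ζ-expValue L ⟨
      ζ (expValue (map +_ L))   ≡⟨ cong (ζ ∘ expValue) eq ⟩
      ζ (expValue (shift k E))  ≡⟨ cong ζ (expValue-shift k E) ⟩
      ζ (powℕ φ k ⊗ expValue E) ≡⟨ cong (λ x → ζ (powℕ φ k ⊗ x)) v ⟩
      ζ (powℕ φ k ⊗ fromℕ N)    ∎

  basePhiExp-unique : ∀ {N E E'} → IsBasePhiExp N E → IsBasePhiExp N E' → E ≡ E'
  basePhiExp-unique {E = E} {E'} isExp isExp′ =
    let k = negDepth E Nat.+ negDepth E'
        L  , eq  , g  , s  = zeckendorfForm k (ℕₚ.m≤m+n _ _) isExp
        L' , eq' , g' , s' = zeckendorfForm k (ℕₚ.m≤n+m _ _) isExp′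
    in shift-injective k (begin
      shift k E
        ≡⟨ eq ⟨
      map +_ L
        ≡⟨ cong (map +_) (zeckendorfSum-injective g g' (ℤₚ.+-injective (trans s (sym s')))) ⟩
      map +_ L'
        ≡⟨ eq' ⟩
      shift k E' ∎)

module NegativeDigits where
  open Nat using (_+_; _<_; _⊔_)
  open Uniqueness using (basePhiExp-unique)

  ⌊⌋-true : ∀ {A : Set} (a? : Dec A) → A → ⌊ a? ⌋ ≡ true
  ⌊⌋-true a? a = trans (isYes≗does a?) (dec-true a? a)

  ⌊⌋-false : ∀ {A : Set} (a? : Dec A) → ¬ A → ⌊ a? ⌋ ≡ false
  ⌊⌋-false a? ¬a = trans (isYes≗does a?) (dec-false a? ¬a)

  -- negativeDigits o w has the digit w_j at index −(o + 1 + j).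
  negativeDigits : ℕ → List Bool → List ℤ
  negativeDigits o []          = []
  negativeDigits o (true ∷ w)  = -[1+ o ] ∷ negativeDigits (suc o) w
  negativeDigits o (false ∷ w) = negativeDigits (suc o) w

  negativeDigits-zeros : ∀ o j w → negativeDigits o (replicate j false ++ w) ≡ negativeDigits (j + o) w
  negativeDigits-zeros o zero    w = refl
  negativeDigits-zeros o (suc j) w =
    trans (negativeDigits-zeros (suc o) j w) (cong (λ t → negativeDigits t w) (ℕₚ.+-suc j o))

  digit-negativeDigits-< : ∀ o w {j} → j < o → digit (negativeDigits o w) -[1+ j ] ≡ false
  digit-negativeDigits-< o []          j<o = refl
  digit-negativeDigits-< o (true ∷ w) {j} j<o = cong₂ _∨_
    (⌊⌋-false (-[1+ o ] Int.≟ -[1+ j ]) (λ eq → ℕₚ.<⇒≢ j<o (sym (ℤₚ.-[1+-injective eq))))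
    (digit-negativeDigits-< (suc o) w (ℕₚ.m<n⇒m<1+n j<o))
  digit-negativeDigits-< o (false ∷ w) j<o = digit-negativeDigits-< (suc o) w (ℕₚ.m<n⇒m<1+n j<o)

  applyUpTo-cong : ∀ {A : Set} {f g : ℕ → A} n → (∀ k → f k ≡ g k) → applyUpTo f n ≡ applyUpTo g n
  applyUpTo-cong zero    f≗g = refl
  applyUpTo-cong (suc n) f≗g = cong₂ _∷_ (f≗g 0) (applyUpTo-cong n (f≗g ∘ suc))

  digits-negativeDigits : ∀ o w → applyUpTo (λ k → digit (negativeDigits o w) -[1+ o + k ]) (length w) ≡ w
  digits-negativeDigits o [] = refl
  digits-negativeDigits o (true ∷ w) = cong₂ _∷_
    (cong (_∨ digit (negativeDigits (suc o) w) -[1+ o + 0 ])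
      (⌊⌋-true (-[1+ o ] Int.≟ -[1+ o + 0 ]) (cong -[1+_] (sym (ℕₚ.+-identityʳ o)))))
    (trans (applyUpTo-cong (length w) later) (digits-negativeDigits (suc o) w))
    where
    later : ∀ k → digit (negativeDigits o (true ∷ w)) -[1+ o + suc k ]
                  ≡ digit (negativeDigits (suc o) w) -[1+ suc o + k ]
    later k = cong₂ _∨_
      (⌊⌋-false (-[1+ o ] Int.≟ -[1+ o + suc k ])
        (λ eq → ℕₚ.<⇒≢ (ℕₚ.m<m+n o (s≤s z≤n)) (ℤₚ.-[1+-injective eq)))
      (cong (λ t → digit (negativeDigits (suc o) w) -[1+ t ]) (ℕₚ.+-suc o k))
  digits-negativeDigits o (false ∷ w) = cong₂ _∷_
    (digit-negativeDigits-< (suc o) w (s≤s (ℕₚ.≤-reflexive (ℕₚ.+-identityʳ o))))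
    (trans (applyUpTo-cong (length w) later) (digits-negativeDigits (suc o) w))
    where
    later : ∀ k → digit (negativeDigits (suc o) w) -[1+ o + suc k ]
                  ≡ digit (negativeDigits (suc o) w) -[1+ suc o + k ]
    later k = cong (λ t → digit (negativeDigits (suc o) w) -[1+ t ]) (ℕₚ.+-suc o k)

  negDepth-negativeDigits : ∀ o u → negDepth (negativeDigits o (u ∷ʳ true)) ≡ o + length (u ∷ʳ true)
  negDepth-negativeDigits o []          = trans (ℕₚ.⊔-identityʳ (suc o)) (ℕₚ.+-comm 1 o)
  negDepth-negativeDigits o (true ∷ u)  = begin
    suc o ⊔ negDepth (negativeDigits (suc o) (u ∷ʳ true))
      ≡⟨ cong (suc o ⊔_) (negDepth-negativeDigits (suc o) u) ⟩
    suc o ⊔ (suc o + length (u ∷ʳ true))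
      ≡⟨ ℕₚ.m≤n⇒m⊔n≡n (ℕₚ.m≤m+n (suc o) _) ⟩
    suc o + length (u ∷ʳ true)
      ≡⟨ ℕₚ.+-suc o _ ⟨
    o + suc (length (u ∷ʳ true)) ∎
  negDepth-negativeDigits o (false ∷ u) = trans (negDepth-negativeDigits (suc o) u) (sym (ℕₚ.+-suc o _))

  betaMinus-negativeDigits : ∀ u → betaMinus (negativeDigits 0 (u ∷ʳ true)) ≡ u ∷ʳ true
  betaMinus-negativeDigits u = begin
    map f (upTo (negDepth (negativeDigits 0 w)))
      ≡⟨ cong (map f ∘ upTo) (negDepth-negativeDigits 0 u) ⟩
    map f (upTo (length w))
      ≡⟨ Listₚ.map-upTo f (length w) ⟩
    applyUpTo f (length w)
      ≡⟨ digits-negativeDigits 0 w ⟩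
    w ∎
    where
    w = u ∷ʳ true
    f = λ k → digit (negativeDigits 0 w) -[1+ k ]

  betaMinus-ignores-nonneg : ∀ P E → betaMinus (map +_ P ++ E) ≡ betaMinus E
  betaMinus-ignores-nonneg []      E = refl
  betaMinus-ignores-nonneg (p ∷ P) E = betaMinus-ignores-nonneg P E

  suffix01 : List Bool
  suffix01 = false ∷ true ∷ []

  take-length-++ : ∀ {A : Set} (u v : List A) → take (length u) (u ++ v) ≡ u
  take-length-++ []      v = refl
  take-length-++ (b ∷ u) v = cong (b ∷_) (take-length-++ u v)

  gammaMinusW-suffix01 : ∀ γ → gammaMinusW (γ ++ suffix01) ≡ γ
  gammaMinusW-suffix01 γ = begin
    take (length (γ ++ suffix01) Nat.∸ 2) (γ ++ suffix01)
      ≡⟨ cong (λ n → take (n Nat.∸ 2) (γ ++ suffix01)) (Listₚ.length-++ γ) ⟩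
    take (length γ + 2 Nat.∸ 2) (γ ++ suffix01)
      ≡⟨ cong (λ n → take n (γ ++ suffix01)) (ℕₚ.m+n∸n≡m (length γ) 2) ⟩
    take (length γ) (γ ++ suffix01)
      ≡⟨ take-length-++ γ suffix01 ⟩
    γ ∎

  expansionWith : List ℕ → List Bool → List ℤ
  expansionWith P γ = map +_ P ++ negativeDigits 0 (γ ++ suffix01)

  gammaMinus-expansionWith : ∀ P γ → gammaMinusW (betaMinus (expansionWith P γ)) ≡ γ
  gammaMinus-expansionWith P γ = begin
    gammaMinusW (betaMinus (expansionWith P γ))
      ≡⟨ cong gammaMinusW (betaMinus-ignores-nonneg P _) ⟩
    gammaMinusW (betaMinus (negativeDigits 0 (γ ++ suffix01)))
      ≡⟨ cong (gammaMinusW ∘ betaMinus ∘ negativeDigits 0) (Listₚ.++-assoc γ _ _) ⟨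
    gammaMinusW (betaMinus (negativeDigits 0 ((γ ∷ʳ false) ∷ʳ true)))
      ≡⟨ cong gammaMinusW (betaMinus-negativeDigits (γ ∷ʳ false)) ⟩
    gammaMinusW ((γ ∷ʳ false) ∷ʳ true)
      ≡⟨ cong gammaMinusW (Listₚ.++-assoc γ _ _) ⟩
    gammaMinusW (γ ++ suffix01)
      ≡⟨ gammaMinusW-suffix01 γ ⟩
    γ ∎

  gammaMinusIs-expansionWith : ∀ {N} P γ → IsBasePhiExp N (expansionWith P γ) → GammaMinusIs N γ
  gammaMinusIs-expansionWith P γ isExp = (_ , isExp) , λ E isExp′ →
    subst (λ F → gammaMinusW (betaMinus F) ≡ γ) (basePhiExp-unique isExp isExp′) (gammaMinus-expansionWith P γ)

module Expansions where
  open Nat using (_+_)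
  open ℤ[φ]
  open Powers
  open NegativeDigits
  open FibonacciLucas using (lucas-pos)

  Gapped-tail : ∀ {x l} → Gapped (x ∷ l) → Gapped l
  Gapped-tail {l = []}    _       = tt
  Gapped-tail {l = _ ∷ _} (_ , g) = g

  expValue-++ : ∀ A B → expValue (A ++ B) ≡ expValue A ⊕ expValue B
  expValue-++ []      B = sym (⊕-identityˡ (expValue B))
  expValue-++ (a ∷ A) B =
    trans (cong (φ^ a ⊕_) (expValue-++ A B)) (sym (⊕-assoc (φ^ a) (expValue A) (expValue B)))

  evens : ℕ → List ℕ
  evens zero    = 0 ∷ []
  evens (suc j) = suc (suc (j + j)) ∷ evens j

  odds : ℕ → List ℕ
  odds zero    = 1 ∷ []
  odds (suc j) = suc (suc (suc (j + j))) ∷ odds j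

  evens-sum : ∀ j → expValue (map +_ (evens j)) ⊕ powℕ φinv 1 ≡ powℕ φ (suc (j + j))
  evens-sum zero    = refl
  evens-sum (suc j) = begin
    (powℕ φ (suc (suc k)) ⊕ R) ⊕ powℕ φinv 1 ≡⟨ ⊕-assoc (powℕ φ (suc (suc k))) R (powℕ φinv 1) ⟩
    powℕ φ (suc (suc k)) ⊕ (R ⊕ powℕ φinv 1) ≡⟨ cong (powℕ φ (suc (suc k)) ⊕_) (evens-sum j) ⟩
    powℕ φ (suc (suc k)) ⊕ powℕ φ (suc k)    ≡⟨ φ^-recurrence (suc k) ⟩
    powℕ φ (suc (suc (suc k)))               ≡⟨ cong (powℕ φ ∘ suc) (ℕₚ.+-suc (suc j) j) ⟨
    powℕ φ (suc (suc j + suc j))             ∎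
    where
    k = j + j
    R = expValue (map +_ (evens j))

  odds-sum : ∀ j → expValue (map +_ (odds j)) ⊕ oneφ ≡ powℕ φ (suc (suc (j + j)))
  odds-sum zero    = refl
  odds-sum (suc j) = begin
    (powℕ φ (suc (suc (suc k))) ⊕ R) ⊕ oneφ  ≡⟨ ⊕-assoc (powℕ φ (suc (suc (suc k)))) R oneφ ⟩
    powℕ φ (suc (suc (suc k))) ⊕ (R ⊕ oneφ)  ≡⟨ cong (powℕ φ (suc (suc (suc k))) ⊕_) (odds-sum j) ⟩
    powℕ φ (suc (suc (suc k))) ⊕ powℕ φ (suc (suc k)) ≡⟨ φ^-recurrence (suc (suc k)) ⟩
    powℕ φ (suc (suc (suc (suc k))))         ≡⟨ cong (powℕ φ ∘ suc ∘ suc) (ℕₚ.+-suc (suc j) j) ⟨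
    powℕ φ (suc (suc (suc j + suc j)))       ∎
    where
    k = j + j
    R = expValue (map +_ (odds j))

  w01-sum : ∀ o j → expValue (negativeDigits o (w01 j)) ⊕ powℕ φinv (suc (j + j + o)) ≡ powℕ φinv (suc o)
  w01-sum o zero    = ⊕-identityˡ _
  w01-sum o (suc j) = begin
    (powℕ φinv (suc (suc o)) ⊕ S) ⊕ powℕ φinv (suc (suc j + suc j + o))
      ≡⟨ ⊕-assoc (powℕ φinv (suc (suc o))) S _ ⟩
    powℕ φinv (suc (suc o)) ⊕ (S ⊕ powℕ φinv (suc (suc j + suc j + o)))
      ≡⟨ cong (λ t → powℕ φinv (suc (suc o)) ⊕ (S ⊕ powℕ φinv (suc t))) (l j o) ⟩
    powℕ φinv (suc (suc o)) ⊕ (S ⊕ powℕ φinv (suc (j + j + suc (suc o))))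
      ≡⟨ cong (powℕ φinv (suc (suc o)) ⊕_) (w01-sum (suc (suc o)) j) ⟩
    powℕ φinv (suc (suc o)) ⊕ powℕ φinv (suc (suc (suc o)))
      ≡⟨ φinv^-recurrence (suc o) ⟩
    powℕ φinv (suc o) ∎
    where
    S = expValue (negativeDigits (suc (suc o)) (w01 j))
    l : ∀ j o → suc j + suc j + o ≡ j + j + suc (suc o)
    l = ℕ-Solver.solve-∀

  w10-sum : ∀ o j → expValue (negativeDigits o (w10 j ++ suffix01)) ⊕ powℕ φinv (suc (j + j + o)) ≡ powℕ φinv o
  w10-sum o zero = begin
    (powℕ φinv (suc (suc o)) ⊕ 0φ) ⊕ powℕ φinv (suc o)
      ≡⟨ cong (_⊕ powℕ φinv (suc o)) (⊕-identityʳ (powℕ φinv (suc (suc o)))) ⟩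
    powℕ φinv (suc (suc o)) ⊕ powℕ φinv (suc o)
      ≡⟨ ⊕-comm (powℕ φinv (suc (suc o))) (powℕ φinv (suc o)) ⟩
    powℕ φinv (suc o) ⊕ powℕ φinv (suc (suc o))
      ≡⟨ φinv^-recurrence o ⟩
    powℕ φinv o ∎
  w10-sum o (suc j) = begin
    (powℕ φinv (suc o) ⊕ S) ⊕ powℕ φinv (suc (suc j + suc j + o))
      ≡⟨ ⊕-assoc (powℕ φinv (suc o)) S _ ⟩
    powℕ φinv (suc o) ⊕ (S ⊕ powℕ φinv (suc (suc j + suc j + o)))
      ≡⟨ cong (λ t → powℕ φinv (suc o) ⊕ (S ⊕ powℕ φinv (suc t))) (l j o) ⟩
    powℕ φinv (suc o) ⊕ (S ⊕ powℕ φinv (suc (j + j + suc (suc o))))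
      ≡⟨ cong (powℕ φinv (suc o) ⊕_) (w10-sum (suc (suc o)) j) ⟩
    powℕ φinv (suc o) ⊕ powℕ φinv (suc (suc o))
      ≡⟨ φinv^-recurrence o ⟩
    powℕ φinv o ∎
    where
    S = expValue (negativeDigits (suc (suc o)) (w10 j ++ suffix01))
    l : ∀ j o → suc j + suc j + o ≡ j + j + suc (suc o)
    l = ℕ-Solver.solve-∀

  -- In Gapped (x ∷ l), a head x outside the expansion bounds the first exponent of l by x − 2.
  evens-gapped : ∀ j X → Gapped (+ 0 ∷ X) → Gapped (+ suc (suc (j + j)) ∷ map +_ (evens j) ++ X)
  evens-gapped zero    X g = ℤₚ.≤-refl , g
  evens-gapped (suc j) X g = +≤+ (ℕₚ.≤-reflexive (l j)) , evens-gapped j X g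
    where
    l : ∀ j → suc (suc (j + j)) + 2 ≡ suc (suc (suc j + suc j))
    l = ℕ-Solver.solve-∀

  odds-gapped : ∀ j X → Gapped (+ 1 ∷ X) → Gapped (+ suc (suc (suc (j + j))) ∷ map +_ (odds j) ++ X)
  odds-gapped zero    X g = ℤₚ.≤-refl , g
  odds-gapped (suc j) X g = +≤+ (ℕₚ.≤-reflexive (l j)) , odds-gapped j X g
    where
    l : ∀ j → suc (suc (suc (j + j))) + 2 ≡ suc (suc (suc (suc j + suc j)))
    l = ℕ-Solver.solve-∀

  w01-gapped : ∀ o j → Gapped (Int.- + o ∷ negativeDigits o (w01 j))
  w01-gapped o zero    = tt
  w01-gapped o (suc j) = gap o , w01-gapped (suc (suc o)) j
    where
    gap : ∀ o → -[1+ suc o ] Int.+ + 2 Int.≤ Int.- + o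
    gap zero    = ℤₚ.≤-refl
    gap (suc o) = ℤₚ.≤-refl

  w10-gapped : ∀ o j → Gapped (-[1+ o ] ∷ negativeDigits (suc (suc o)) (w10 j ++ suffix01))
  w10-gapped o zero    = -≤- (ℕₚ.n≤1+n o) , tt
  w10-gapped o (suc j) = ℤₚ.≤-refl , w10-gapped (suc (suc o)) j

  negative+2≤positive : ∀ k a → -[1+ k ] Int.+ + 2 Int.≤ + suc a
  negative+2≤positive zero          a = +≤+ (s≤s z≤n)
  negative+2≤positive (suc zero)    a = +≤+ z≤n
  negative+2≤positive (suc (suc k)) a = -≤+

  zeros-suffix01 : ∀ k → negativeDigits 0 (zeros k ++ suffix01) ≡ -[1+ suc k ] ∷ []
  zeros-suffix01 k =
    trans (negativeDigits-zeros 0 k suffix01) (cong (λ t → -[1+ suc t ] ∷ []) (ℕₚ.+-identityʳ k))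

  w01-suffix01 : ∀ m → w01 m ++ suffix01 ≡ w01 (suc m)
  w01-suffix01 zero    = refl
  w01-suffix01 (suc m) = cong (λ w → false ∷ true ∷ w) (w01-suffix01 m)

  lucas-even-expansion : ∀ m → let k = m + m in
    IsBasePhiExp (lucas (suc (suc k))) (expansionWith (suc (suc k) ∷ []) (zeros k))
  lucas-even-expansion m = subst (λ X → IsBasePhiExp (lucas (suc (suc k))) (+ suc (suc k) ∷ X))
    (sym (zeros-suffix01 k)) ((negative+2≤positive (suc k) (suc k) , tt) , value)
    where
    k = m + m
    value : powℕ φ (suc (suc k)) ⊕ (powℕ φinv (suc (suc k)) ⊕ 0φ) ≡ fromℕ (lucas (suc (suc k)))
    value = trans (cong (powℕ φ (suc (suc k)) ⊕_) (⊕-identityʳ (powℕ φinv (suc (suc k))))) (lucas-even m)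

  lucas-odd-expansion : ∀ m → let i = suc m in
    IsBasePhiExp (lucas (suc (i + i))) (expansionWith (evens i) (w01 m))
  lucas-odd-expansion m rewrite w01-suffix01 m = gapped , value
    where
    i = suc m
    K = suc (i + i)
    P = expValue (map +_ (evens i))
    Q = expValue (negativeDigits 0 (w01 i))
    gapped : Gapped (map +_ (evens i) ++ negativeDigits 0 (w01 i))
    gapped = Gapped-tail (evens-gapped i _ (w01-gapped 0 i))
    value : expValue (map +_ (evens i) ++ negativeDigits 0 (w01 i)) ≡ fromℕ (lucas K)
    value = trans (expValue-++ (map +_ (evens i)) _) (⊕-cancelʳ (powℕ φinv K) _ _ (begin
      (P ⊕ Q) ⊕ powℕ φinv K
        ≡⟨ ⊕-assoc P Q (powℕ φinv K) ⟩
      P ⊕ (Q ⊕ powℕ φinv K)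
        ≡⟨ cong (λ t → P ⊕ (Q ⊕ powℕ φinv (suc t))) (ℕₚ.+-identityʳ (i + i)) ⟨
      P ⊕ (Q ⊕ powℕ φinv (suc (i + i + 0)))
        ≡⟨ cong (P ⊕_) (w01-sum 0 i) ⟩
      P ⊕ powℕ φinv 1
        ≡⟨ evens-sum i ⟩
      powℕ φ K
        ≡⟨ lucas-odd i ⟨
      fromℕ (lucas K) ⊕ powℕ φinv K ∎))

  lucas-odd-plus-one-expansion : ∀ m → let i = suc m in
    IsBasePhiExp (lucas (suc (i + i)) + 1) (expansionWith (suc (i + i) ∷ []) (w10 i))
  lucas-odd-plus-one-expansion m = gapped , value
    where
    i = suc m
    K = suc (i + i)
    Q = expValue (negativeDigits 0 (w10 i ++ suffix01))
    gapped : Gapped (+ K ∷ negativeDigits 0 (w10 i ++ suffix01))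
    gapped = negative+2≤positive 0 (i + i) , w10-gapped 0 m
    value : powℕ φ K ⊕ Q ≡ fromℕ (lucas K + 1)
    value = ⊕-cancelʳ (powℕ φinv K) _ _ (begin
      (powℕ φ K ⊕ Q) ⊕ powℕ φinv K
        ≡⟨ ⊕-assoc (powℕ φ K) Q (powℕ φinv K) ⟩
      powℕ φ K ⊕ (Q ⊕ powℕ φinv K)
        ≡⟨ cong (λ t → powℕ φ K ⊕ (Q ⊕ powℕ φinv (suc t))) (ℕₚ.+-identityʳ (i + i)) ⟨
      powℕ φ K ⊕ (Q ⊕ powℕ φinv (suc (i + i + 0)))
        ≡⟨ cong (powℕ φ K ⊕_) (w10-sum 0 i) ⟩
      powℕ φ K ⊕ oneφ
        ≡⟨ cong (_⊕ oneφ) (lucas-odd i) ⟨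
      (fromℕ (lucas K) ⊕ powℕ φinv K) ⊕ oneφ
        ≡⟨ ⊕-swapʳ (fromℕ (lucas K)) (powℕ φinv K) oneφ ⟩
      fromℕ (lucas K + 1) ⊕ powℕ φinv K ∎)

  lucas-even-minus-one-expansion : ∀ i → let k = i + i in
    IsBasePhiExp (lucas (suc (suc k)) Nat.∸ 1) (expansionWith (odds i) (zeros k))
  lucas-even-minus-one-expansion i =
    subst (λ X → IsBasePhiExp (L Nat.∸ 1) (map +_ (odds i) ++ X)) (sym (zeros-suffix01 k)) (gapped , value)
    where
    k = i + i
    L = lucas (suc (suc k))
    P = expValue (map +_ (odds i))
    X = -[1+ suc k ] ∷ []
    gapped : Gapped (map +_ (odds i) ++ X)
    gapped = Gapped-tail (odds-gapped i X (negative+2≤positive (suc k) 0 , tt))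
    value : expValue (map +_ (odds i) ++ X) ≡ fromℕ (L Nat.∸ 1)
    value = ⊕-cancelʳ oneφ _ _ (begin
      expValue (map +_ (odds i) ++ X) ⊕ oneφ
        ≡⟨ cong (_⊕ oneφ) (expValue-++ (map +_ (odds i)) X) ⟩
      (P ⊕ (powℕ φinv (suc (suc k)) ⊕ 0φ)) ⊕ oneφ
        ≡⟨ cong (λ t → (P ⊕ t) ⊕ oneφ) (⊕-identityʳ (powℕ φinv (suc (suc k)))) ⟩
      (P ⊕ powℕ φinv (suc (suc k))) ⊕ oneφ
        ≡⟨ ⊕-swapʳ P (powℕ φinv (suc (suc k))) oneφ ⟩
      (P ⊕ oneφ) ⊕ powℕ φinv (suc (suc k))
        ≡⟨ cong (_⊕ powℕ φinv (suc (suc k))) (odds-sum i) ⟩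
      powℕ φ (suc (suc k)) ⊕ powℕ φinv (suc (suc k))
        ≡⟨ lucas-even i ⟩
      fromℕ L
        ≡⟨ cong fromℕ (ℕₚ.m∸n+n≡m (lucas-pos (suc (suc k)))) ⟨
      fromℕ (L Nat.∸ 1) ⊕ oneφ ∎)

module ZeckendorfWords where
  open Nat using (_+_)

  zinvRev-++ : ∀ xs ys i → zinvRev (xs ++ ys) i ≡ zinvRev xs i + zinvRev ys (length xs + i)
  zinvRev-++ []       ys i = refl
  zinvRev-++ (b ∷ xs) ys i = begin
    e + zinvRev (xs ++ ys) (suc i)
      ≡⟨ cong (λ t → e + t) (zinvRev-++ xs ys (suc i)) ⟩
    e + (zinvRev xs (suc i) + zinvRev ys (length xs + suc i))
      ≡⟨ ℕₚ.+-assoc e _ _ ⟨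
    (e + zinvRev xs (suc i)) + zinvRev ys (length xs + suc i)
      ≡⟨ cong (λ j → (e + zinvRev xs (suc i)) + zinvRev ys j) (ℕₚ.+-suc (length xs) i) ⟩
    (e + zinvRev xs (suc i)) + zinvRev ys (suc (length xs + i)) ∎
    where e = if b then fib (i + 2) else 0

  Zinv-++ : ∀ u v → Zinv (u ++ v) ≡ zinvRev (reverse u) (length v) + Zinv v
  Zinv-++ u v = begin
    zinvRev (reverse (u ++ v)) 0
      ≡⟨ cong (λ w → zinvRev w 0) (Listₚ.reverse-++ u v) ⟩
    zinvRev (reverse v ++ reverse u) 0
      ≡⟨ zinvRev-++ (reverse v) (reverse u) 0 ⟩
    Zinv v + zinvRev (reverse u) (length (reverse v) + 0)
      ≡⟨ cong (λ j → Zinv v + zinvRev (reverse u) j) (trans (ℕₚ.+-identityʳ _) (Listₚ.length-reverse v)) ⟩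
    Zinv v + zinvRev (reverse u) (length v)
      ≡⟨ ℕₚ.+-comm (Zinv v) _ ⟩
    zinvRev (reverse u) (length v) + Zinv v ∎

  length-pairs : ∀ m (a b : Bool) → length (concat (replicate m (a ∷ b ∷ []))) ≡ m + m
  length-pairs zero    a b = refl
  length-pairs (suc m) a b = trans (cong (suc ∘ suc) (length-pairs m a b)) (cong suc (sym (ℕₚ.+-suc m m)))

  Zinv-zeros : ∀ k → Zinv (zeros k) ≡ 0
  Zinv-zeros zero    = refl
  Zinv-zeros (suc k) = trans (Zinv-++ (false ∷ []) (zeros k)) (Zinv-zeros k)

  Zinv-w01+1 : ∀ m → Zinv (w01 m) + 1 ≡ fib (suc (m + m))
  Zinv-w01+1 zero    = refl
  Zinv-w01+1 (suc m) = begin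
    Zinv (w01 (suc m)) + 1
      ≡⟨ cong (_+ 1) (Zinv-++ (false ∷ true ∷ []) (w01 m)) ⟩
    (fib (length (w01 m) + 2) + 0 + Zinv (w01 m)) + 1
      ≡⟨ cong (λ j → (fib (j + 2) + 0 + Zinv (w01 m)) + 1) (length-pairs m false true) ⟩
    (fib (m + m + 2) + 0 + Zinv (w01 m)) + 1
      ≡⟨ l (fib (m + m + 2)) (Zinv (w01 m)) ⟩
    fib (m + m + 2) + (Zinv (w01 m) + 1)
      ≡⟨ cong₂ _+_ (cong fib (ℕₚ.+-comm (m + m) 2)) (Zinv-w01+1 m) ⟩
    fib (suc (suc (m + m))) + fib (suc (m + m))
      ≡⟨ cong (fib ∘ suc) (ℕₚ.+-suc (suc m) m) ⟨
    fib (suc (suc m + suc m)) ∎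
    where
    l : ∀ a z → (a + 0 + z) + 1 ≡ a + (z + 1)
    l = ℕ-Solver.solve-∀

  Zinv-w10+1 : ∀ m → Zinv (w10 m) + 1 ≡ fib (suc (suc (m + m)))
  Zinv-w10+1 zero    = refl
  Zinv-w10+1 (suc m) = begin
    Zinv (w10 (suc m)) + 1
      ≡⟨ cong (_+ 1) (Zinv-++ (true ∷ false ∷ []) (w10 m)) ⟩
    (0 + (fib (suc (length (w10 m)) + 2) + 0) + Zinv (w10 m)) + 1
      ≡⟨ cong (λ j → (0 + (fib (suc j + 2) + 0) + Zinv (w10 m)) + 1) (length-pairs m true false) ⟩
    (0 + (fib (suc (m + m) + 2) + 0) + Zinv (w10 m)) + 1
      ≡⟨ l (fib (suc (m + m) + 2)) (Zinv (w10 m)) ⟩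
    fib (suc (m + m) + 2) + (Zinv (w10 m) + 1)
      ≡⟨ cong₂ _+_ (cong fib (ℕₚ.+-comm (suc (m + m)) 2)) (Zinv-w10+1 m) ⟩
    fib (suc (suc (suc (m + m)))) + fib (suc (suc (m + m)))
      ≡⟨ cong (fib ∘ suc ∘ suc) (ℕₚ.+-suc (suc m) m) ⟨
    fib (suc (suc (suc m + suc m))) ∎
    where
    l : ∀ a z → (0 + (a + 0) + z) + 1 ≡ a + (z + 1)
    l = ℕ-Solver.solve-∀

open import Data.Nat using (_+_; _*_; _∸_; _≤_)
open NegativeDigits using (gammaMinusIs-expansionWith)
open Expansions
open ZeckendorfWords

CIs-from-GammaMinusIs : ∀ {N w c} → GammaMinusIs N w → Zinv w ≡ c → CIs N c
CIs-from-GammaMinusIs (exp , γ≡w) Zw≡c = exp , λ E isExp → trans (cong Zinv (γ≡w E isExp)) Zw≡c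

2*[1+m]≡2+m+m : ∀ m → 2 * suc m ≡ suc (suc (m + m))
2*[1+m]≡2+m+m = ℕ-Solver.solve-∀

2*n≡n+n : ∀ n → 2 * n ≡ n + n
2*n≡n+n = ℕ-Solver.solve-∀

2*n+1≡1+n+n : ∀ n → 2 * n + 1 ≡ suc (n + n)
2*n+1≡1+n+n = ℕ-Solver.solve-∀

2*n+2≡2+n+n : ∀ n → 2 * n + 2 ≡ suc (suc (n + n))
2*n+2≡2+n+n = ℕ-Solver.solve-∀

γ⁻-lucas-even : ∀ m → GammaMinusIs (lucas (2 * suc m)) (zeros (2 * suc m ∸ 2))
γ⁻-lucas-even m = subst (λ k → GammaMinusIs (lucas k) (zeros (k ∸ 2))) (sym (2*[1+m]≡2+m+m m))
  (gammaMinusIs-expansionWith (suc (suc (m + m)) ∷ []) (zeros (m + m)) (lucas-even-expansion m))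

γ⁻-lucas-odd : ∀ m → GammaMinusIs (lucas (2 * suc m + 1)) (w01 m)
γ⁻-lucas-odd m = subst (λ k → GammaMinusIs (lucas k) (w01 m)) (sym (2*n+1≡1+n+n (suc m)))
  (gammaMinusIs-expansionWith (evens (suc m)) (w01 m) (lucas-odd-expansion m))

γ⁻-lucas-odd-plus-one : ∀ m → let n = suc m in GammaMinusIs (lucas (2 * n + 1) + 1) (w10 n)
γ⁻-lucas-odd-plus-one m = subst (λ k → GammaMinusIs (lucas k + 1) (w10 n)) (sym (2*n+1≡1+n+n n))
  (gammaMinusIs-expansionWith (suc (n + n) ∷ []) (w10 n) (lucas-odd-plus-one-expansion m))
  where n = suc m

γ⁻-lucas-even-minus-one : ∀ n → GammaMinusIs (lucas (2 * n + 2) ∸ 1) (zeros (2 * n))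
γ⁻-lucas-even-minus-one n =
  subst₂ (λ k l → GammaMinusIs (lucas k ∸ 1) (zeros l)) (sym (2*n+2≡2+n+n n)) (sym (2*n≡n+n n))
    (gammaMinusIs-expansionWith (odds n) (zeros (n + n)) (lucas-even-minus-one-expansion n))

Zinv-w01 : ∀ m → Zinv (w01 m) ≡ fib (2 * suc m ∸ 1) ∸ 1
Zinv-w01 m = begin
  Zinv (w01 m)                 ≡⟨ ℕₚ.m+n∸n≡m _ 1 ⟨
  Zinv (w01 m) + 1 ∸ 1         ≡⟨ cong (_∸ 1) (Zinv-w01+1 m) ⟩
  fib (suc (m + m)) ∸ 1        ≡⟨ cong (λ k → fib (k ∸ 1) ∸ 1) (2*[1+m]≡2+m+m m) ⟨
  fib (2 * suc m ∸ 1) ∸ 1      ∎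

Zinv-w10 : ∀ n → Zinv (w10 n) ≡ fib (2 * n + 2) ∸ 1
Zinv-w10 n = begin
  Zinv (w10 n)                 ≡⟨ ℕₚ.m+n∸n≡m _ 1 ⟨
  Zinv (w10 n) + 1 ∸ 1         ≡⟨ cong (_∸ 1) (Zinv-w10+1 n) ⟩
  fib (suc (suc (n + n))) ∸ 1  ≡⟨ cong (λ k → fib k ∸ 1) (2*n+2≡2+n+n n) ⟨
  fib (2 * n + 2) ∸ 1          ∎

lemma7p4 : ∀ (n : ℕ) → 1 ≤ n →
    (GammaMinusIs (lucas (2 * n)) (zeros (2 * n ∸ 2))
     × GammaMinusIs (lucas (2 * n + 1)) (w01 (n ∸ 1))
     × GammaMinusIs (lucas (2 * n + 1) + 1) (w10 n)
     × GammaMinusIs (lucas (2 * n + 2) ∸ 1) (zeros (2 * n)))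
    × (CIs (lucas (2 * n)) 0
     × CIs (lucas (2 * n + 1)) (fib (2 * n ∸ 1) ∸ 1)
     × CIs (lucas (2 * n + 1) + 1) (fib (2 * n + 2) ∸ 1)
     × CIs (lucas (2 * n + 2) ∸ 1) 0)
lemma7p4 (suc m) _ =
  (γ⁻-lucas-even m , γ⁻-lucas-odd m , γ⁻-lucas-odd-plus-one m , γ⁻-lucas-even-minus-one n) ,
  (CIs-from-GammaMinusIs (γ⁻-lucas-even m) (Zinv-zeros (2 * n ∸ 2)) ,
   CIs-from-GammaMinusIs (γ⁻-lucas-odd m) (Zinv-w01 m) ,
   CIs-from-GammaMinusIs (γ⁻-lucas-odd-plus-one m) (Zinv-w10 n) ,
   CIs-from-GammaMinusIs (γ⁻-lucas-even-minus-one n) (Zinv-zeros (2 * n)))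
  where n = suc m
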